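{- Let $k\ge5$ be an odd integer and let $N(x,y)$ be a necklace with end vertices $x,y$ whose distance in $N(x,y)$ satisfies $d(x,y)\ge k$. Then every assignment $\varphi$ of $\frac{k-1}{2}$-element subsets of $\{1,\dots,k\}$ to $x$ and $y$ extends to a fractional $(k:\frac{k-1}{2})$-coloring of $N(x,y)$.
   Context: A fractional $(k:\frac{k-1}{2})$-coloring of a graph assigns to each vertex $v$ a $\frac{k-1}{2}$-element subset $\varphi(v)\subseteq\{1,\dots,k\}$ with $\varphi(u)\cap\varphi(v)=\emptyset$ for every edge $uv$. A necklace $N(x,y)$ with end vertices $x,y$ is a graph obtained from a path $x=z_0z_1\cdots z_m=y$ by replacing some of its edges $z_iz_{i+1}$ by a $k$-cycle passing through $z_i$ and $z_{i+1}$ whose remaining vertices are new (distinct replaced edges receive disjoint sets of new vertices). -}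

module Defs where

open import Data.Nat using (ℕ; zero; suc; _+_; _≤_)
open import Data.Fin using (Fin; zero; suc; inject₁; fromℕ)
open import Data.Fin.Subset using (Subset; _∩_; ⊥; ∣_∣)
open import Data.List using (List; []; _∷_)
open import Data.List.Relation.Unary.All using (All)
open import Data.Maybe using (Maybe; nothing; just)
open import Data.Sum using (_⊎_; inj₁; inj₂)
open import Data.Product using (_×_; Σ-syntax)
open import Data.Unit using (⊤; tt)
open import Data.Empty renaming (⊥ to Empty)
open import Relation.Binary.PropositionalEquality using (_≡_)

-- A necklace is described by the list of its "beads", one per edge
-- z_i z_{i+1} of the underlying path x = z_0 … z_m = y.
--   * edge        : the edge z_i z_{i+1} is kept;
--   * cycle a b   : the edge is replaced by a cycle through z_i and
--                   z_{i+1}, consisting of two internally disjoint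
--                   z_i–z_{i+1} arcs having a resp. b internal (new)
--                   vertices.

data Bead : Set where
  edge  : Bead
  cycle : ℕ → ℕ → Bead

data ValidBead (k : ℕ) : Bead → Set where
  edge-ok  : ValidBead k edge
  cycle-ok : ∀ {a b} → a + b + 2 ≡ k → ValidBead k (cycle a b)

IsNecklace : ℕ → List Bead → Set
IsNecklace k bs = All (ValidBead k) bs

Internal : Bead → Set
Internal edge        = Empty
Internal (cycle a b) = Fin a ⊎ Fin b

-- For b ∷ bs:
--   inj₁ nothing  = the first path vertex z_0 of this bead,
--   inj₁ (just i) = new vertex i of the first bead,
--   inj₂ v        = vertex v of the remaining necklace (starting at z_1).
Vertex : List Bead → Set
Vertex []       = ⊤
Vertex (b ∷ bs) = Maybe (Internal b) ⊎ Vertex bs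

startV : (bs : List Bead) → Vertex bs
startV []       = tt
startV (b ∷ bs) = inj₁ nothing

endV : (bs : List Bead) → Vertex bs
endV []       = tt
endV (b ∷ bs) = inj₂ (endV bs)

data APos (n : ℕ) : Set where
  s e : APos n
  m   : Fin n → APos n

-- consecutive vertices on the arc  s – m 0 – … – m (n-1) – e
data Step : (n : ℕ) → APos n → APos n → Set where
  s→e : Step zero s e
  s→m : ∀ {n} → Step (suc n) s (m zero)
  m→m : ∀ {n} (j : Fin n) → Step (suc n) (m (inject₁ j)) (m (suc j))
  m→e : ∀ {n} → Step (suc n) (m (fromℕ n)) e

data BPos (b : Bead) : Set where
  start end : BPos b
  int       : Internal b → BPos b

lift₁ : ∀ {a b} → APos a → BPos (cycle a b)
lift₁ s     = start
lift₁ e     = end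
lift₁ (m j) = int (inj₁ j)

lift₂ : ∀ {a b} → APos b → BPos (cycle a b)
lift₂ s     = start
lift₂ e     = end
lift₂ (m j) = int (inj₂ j)

data BAdj : (b : Bead) → BPos b → BPos b → Set where
  plain : BAdj edge start end
  arc₁  : ∀ {a b p q} → Step a p q → BAdj (cycle a b) (lift₁ p) (lift₁ q)
  arc₂  : ∀ {a b p q} → Step b p q → BAdj (cycle a b) (lift₂ p) (lift₂ q)

embed : (b : Bead) (bs : List Bead) → BPos b → Vertex (b ∷ bs)
embed b bs start   = inj₁ nothing
embed b bs end     = inj₂ (startV bs)
embed b bs (int i) = inj₁ (just i)

data Adj : (bs : List Bead) → Vertex bs → Vertex bs → Set where
  here  : ∀ {b bs p q} → BAdj b p q → Adj (b ∷ bs) (embed b bs p) (embed b bs q)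
  there : ∀ {b bs u v} → Adj bs u v → Adj (b ∷ bs) (inj₂ u) (inj₂ v)

Edge : (bs : List Bead) → Vertex bs → Vertex bs → Set
Edge bs u v = Adj bs u v ⊎ Adj bs v u

data Walk (bs : List Bead) : Vertex bs → Vertex bs → ℕ → Set where
  nil  : ∀ {u} → Walk bs u u 0
  cons : ∀ {u v w n} → Edge bs u v → Walk bs v w n → Walk bs u w (suc n)

DistAtLeast : (bs : List Bead) → Vertex bs → Vertex bs → ℕ → Set
DistAtLeast bs u v d = ∀ n → Walk bs u v n → d ≤ n

IsFracColouring : (k r : ℕ) (bs : List Bead) → (Vertex bs → Subset k) → Set
IsFracColouring k r bs φ =
  (∀ v → ∣ φ v ∣ ≡ r) × (∀ u v → Edge bs u v → φ u ∩ φ v ≡ ⊥)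

-- A (2r + 1 : r)-colouring of a path is a walk in the Kneser graph K(2r + 1, r), and two
-- r-sets meeting in a points are joined there by walks of every odd length ≥ 2a + 1 and
-- every even length ≥ 2(r − a).  Hence a bead, a (2r + 1)-cycle with arcs of lengths
-- 2α + 1 and 2σ, can be coloured as soon as its two end colours meet in exactly α points,
-- and an edge is the case α = 0.  The necklace is coloured bead by bead from x.  The
-- invariant `Admissible L a b` relates the overlap of the current end colour with the
-- colour of y to the length L of the remaining necklace; it can be kept because the end
-- colour of the next bead only has to satisfy triangle inequalities for the sizes of the
-- set differences, and for L = 0 it forces the colour of y.  Initially L ≥ d(x, y) ≥ 2r + 1
-- and the invariant holds whatever the colours of x and y are.

module Submission where

open import Data.Bool using (true; false)
open import Data.Empty using (⊥-elim)
open import Data.Fin using (Fin; zero; suc)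
open import Data.Fin.Subset using (Subset; ∣_∣; _∩_; _∪_; _─_; ∁; ⊥)
open import Data.Fin.Subset.Properties using (∩-comm)
open import Data.List using (List; []; _∷_)
open import Data.List.Relation.Unary.All as All using (All; []; _∷_)
open import Data.Maybe using (nothing; just)
open import Data.Nat using (ℕ; zero; suc; _+_; _*_; _≤_; _⊓_; _⊔_; _∸_; ⌊_/2⌋; z≤n; s≤s)
open import Data.Nat.Properties
open import Algebra.Properties.CommutativeSemigroup +-commutativeSemigroup
  using (interchange; xy∙z≈xz∙y; xy∙z≈x∙zy)
open import Data.Nat.Tactic.RingSolver using (solve-∀)
open import Data.Product using (_×_; Σ-syntax; _,_; proj₁; proj₂)
open import Data.Sum using (_⊎_; inj₁; inj₂)
open import Data.Vec using ([]; _∷_)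
open import Data.Vec.Functional using () renaming (_∷_ to _∷ᶠ_)
open import Relation.Binary.PropositionalEquality

open import Defs

∣p∣≡0⇒p≡⊥ : ∀ {n} (p : Subset n) → ∣ p ∣ ≡ 0 → p ≡ ⊥
∣p∣≡0⇒p≡⊥ []          _  = refl
∣p∣≡0⇒p≡⊥ (false ∷ p) eq = cong (false ∷_) (∣p∣≡0⇒p≡⊥ p eq)

∣p─q∣≡0⇒∣q─p∣≡0⇒p≡q : ∀ {n} (p q : Subset n) → ∣ p ─ q ∣ ≡ 0 → ∣ q ─ p ∣ ≡ 0 → p ≡ q
∣p─q∣≡0⇒∣q─p∣≡0⇒p≡q []          []          _ _ = refl
∣p─q∣≡0⇒∣q─p∣≡0⇒p≡q (true  ∷ p) (true  ∷ q) d d′ = cong (true ∷_) (∣p─q∣≡0⇒∣q─p∣≡0⇒p≡q p q d d′)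
∣p─q∣≡0⇒∣q─p∣≡0⇒p≡q (false ∷ p) (false ∷ q) d d′ = cong (false ∷_) (∣p─q∣≡0⇒∣q─p∣≡0⇒p≡q p q d d′)

∣p∣≡∣p∩q∣+∣p─q∣ : ∀ {n} (p q : Subset n) → ∣ p ∣ ≡ ∣ p ∩ q ∣ + ∣ p ─ q ∣
∣p∣≡∣p∩q∣+∣p─q∣ []            []            = refl
∣p∣≡∣p∩q∣+∣p─q∣ (true  ∷ p) (true  ∷ q) = cong suc (∣p∣≡∣p∩q∣+∣p─q∣ p q)
∣p∣≡∣p∩q∣+∣p─q∣ (true  ∷ p) (false ∷ q) =
  trans (cong suc (∣p∣≡∣p∩q∣+∣p─q∣ p q)) (sym (+-suc ∣ p ∩ q ∣ ∣ p ─ q ∣))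
∣p∣≡∣p∩q∣+∣p─q∣ (false ∷ p) (true  ∷ q) = ∣p∣≡∣p∩q∣+∣p─q∣ p q
∣p∣≡∣p∩q∣+∣p─q∣ (false ∷ p) (false ∷ q) = ∣p∣≡∣p∩q∣+∣p─q∣ p q

∣p∩q∣+∣p─q∣+∣q─p∣+∣∁p∪q∣≡n : ∀ {n} (p q : Subset n) →
  ∣ p ∩ q ∣ + ∣ p ─ q ∣ + ∣ q ─ p ∣ + ∣ ∁ (p ∪ q) ∣ ≡ n
∣p∩q∣+∣p─q∣+∣q─p∣+∣∁p∪q∣≡n [] [] = refl
∣p∩q∣+∣p─q∣+∣q─p∣+∣∁p∪q∣≡n (true  ∷ p) (true  ∷ q) = cong suc (∣p∩q∣+∣p─q∣+∣q─p∣+∣∁p∪q∣≡n p q)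
∣p∩q∣+∣p─q∣+∣q─p∣+∣∁p∪q∣≡n (true  ∷ p) (false ∷ q) =
  trans (lemma (∣ p ∩ q ∣) (∣ p ─ q ∣) (∣ q ─ p ∣) (∣ ∁ (p ∪ q) ∣))
        (cong suc (∣p∩q∣+∣p─q∣+∣q─p∣+∣∁p∪q∣≡n p q))
  where
  lemma : ∀ w x y z → w + suc x + y + z ≡ suc (w + x + y + z)
  lemma = solve-∀
∣p∩q∣+∣p─q∣+∣q─p∣+∣∁p∪q∣≡n (false ∷ p) (true  ∷ q) =
  trans (lemma (∣ p ∩ q ∣) (∣ p ─ q ∣) (∣ q ─ p ∣) (∣ ∁ (p ∪ q) ∣))
        (cong suc (∣p∩q∣+∣p─q∣+∣q─p∣+∣∁p∪q∣≡n p q))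
  where
  lemma : ∀ w x y z → w + x + suc y + z ≡ suc (w + x + y + z)
  lemma = solve-∀
∣p∩q∣+∣p─q∣+∣q─p∣+∣∁p∪q∣≡n (false ∷ p) (false ∷ q) =
  trans (+-suc _ _) (cong suc (∣p∩q∣+∣p─q∣+∣q─p∣+∣∁p∪q∣≡n p q))

record Profile {n} (X Y : Subset n) (both onlyX onlyY neither : ℕ) : Set where
  constructor profile
  field
    ∣X∩Y∣  : ∣ X ∩ Y ∣ ≡ both
    ∣X─Y∣  : ∣ X ─ Y ∣ ≡ onlyX
    ∣Y─X∣  : ∣ Y ─ X ∣ ≡ onlyY
    ∣∁X∪Y∣ : ∣ ∁ (X ∪ Y) ∣ ≡ neither

profile-cast : ∀ {n} {X Y : Subset n} {w x y z w′ x′ y′ z′} →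
  w ≡ w′ → x ≡ x′ → y ≡ y′ → z ≡ z′ → Profile X Y w x y z → Profile X Y w′ x′ y′ z′
profile-cast refl refl refl refl P = P

private
  suc-right : ∀ {c} a b → c ≡ a + b → suc c ≡ a + suc b
  suc-right a b c≡a+b = trans (cong suc c≡a+b) (sym (+-suc a b))

  zero-sum : ∀ a b → 0 ≡ a + b → a ≡ 0 × b ≡ 0
  zero-sum zero zero _ = refl , refl

-- D takes p elements of X ∩ Y, q of X ─ Y, y of Y ─ X and o of neither; the primed
-- numbers count what it leaves.
subset-with-cell-counts : ∀ {n} (X Y : Subset n) (p p′ q q′ y y′ o o′ : ℕ) →
  Profile X Y (p + p′) (q + q′) (y + y′) (o + o′) →
  Σ[ D ∈ Subset n ] Profile D Y (p + y) (q + o) (p′ + y′) (q′ + o′)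
                  × Profile X D (p + q) (p′ + q′) (y + o) (y′ + o′)
subset-with-cell-counts [] [] p p′ q q′ y y′ o o′ (profile e₁ e₂ e₃ e₄)
  with zero-sum p p′ e₁ | zero-sum q q′ e₂ | zero-sum y y′ e₃ | zero-sum o o′ e₄
... | refl , refl | refl , refl | refl , refl | refl , refl =
  [] , profile refl refl refl refl , profile refl refl refl refl
subset-with-cell-counts (true ∷ X) (true ∷ Y) (suc p) p′ q q′ y y′ o o′ (profile e₁ e₂ e₃ e₄)
  with subset-with-cell-counts X Y p p′ q q′ y y′ o o′ (profile (suc-injective e₁) e₂ e₃ e₄)
... | D , profile f₁ f₂ f₃ f₄ , profile g₁ g₂ g₃ g₄ =
  true ∷ D , profile (cong suc f₁) f₂ f₃ f₄ , profile (cong suc g₁) g₂ g₃ g₄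
subset-with-cell-counts (true ∷ X) (true ∷ Y) zero (suc p′) q q′ y y′ o o′ (profile e₁ e₂ e₃ e₄)
  with subset-with-cell-counts X Y 0 p′ q q′ y y′ o o′ (profile (suc-injective e₁) e₂ e₃ e₄)
... | D , profile f₁ f₂ f₃ f₄ , profile g₁ g₂ g₃ g₄ =
  false ∷ D , profile f₁ f₂ (cong suc f₃) f₄ , profile g₁ (cong suc g₂) g₃ g₄
subset-with-cell-counts (true ∷ X) (false ∷ Y) p p′ (suc q) q′ y y′ o o′ (profile e₁ e₂ e₃ e₄)
  with subset-with-cell-counts X Y p p′ q q′ y y′ o o′ (profile e₁ (suc-injective e₂) e₃ e₄)
... | D , profile f₁ f₂ f₃ f₄ , profile g₁ g₂ g₃ g₄ =
  true ∷ D , profile f₁ (cong suc f₂) f₃ f₄ , profile (suc-right p q g₁) g₂ g₃ g₄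
subset-with-cell-counts (true ∷ X) (false ∷ Y) p p′ zero (suc q′) y y′ o o′ (profile e₁ e₂ e₃ e₄)
  with subset-with-cell-counts X Y p p′ 0 q′ y y′ o o′ (profile e₁ (suc-injective e₂) e₃ e₄)
... | D , profile f₁ f₂ f₃ f₄ , profile g₁ g₂ g₃ g₄ =
  false ∷ D , profile f₁ f₂ f₃ (cong suc f₄) , profile g₁ (suc-right p′ q′ g₂) g₃ g₄
subset-with-cell-counts (false ∷ X) (true ∷ Y) p p′ q q′ (suc y) y′ o o′ (profile e₁ e₂ e₃ e₄)
  with subset-with-cell-counts X Y p p′ q q′ y y′ o o′ (profile e₁ e₂ (suc-injective e₃) e₄)
... | D , profile f₁ f₂ f₃ f₄ , profile g₁ g₂ g₃ g₄ =
  true ∷ D , profile (suc-right p y f₁) f₂ f₃ f₄ , profile g₁ g₂ (cong suc g₃) g₄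
subset-with-cell-counts (false ∷ X) (true ∷ Y) p p′ q q′ zero (suc y′) o o′ (profile e₁ e₂ e₃ e₄)
  with subset-with-cell-counts X Y p p′ q q′ 0 y′ o o′ (profile e₁ e₂ (suc-injective e₃) e₄)
... | D , profile f₁ f₂ f₃ f₄ , profile g₁ g₂ g₃ g₄ =
  false ∷ D , profile f₁ f₂ (suc-right p′ y′ f₃) f₄ , profile g₁ g₂ g₃ (cong suc g₄)
subset-with-cell-counts (false ∷ X) (false ∷ Y) p p′ q q′ y y′ (suc o) o′ (profile e₁ e₂ e₃ e₄)
  with subset-with-cell-counts X Y p p′ q q′ y y′ o o′ (profile e₁ e₂ e₃ (suc-injective e₄))
... | D , profile f₁ f₂ f₃ f₄ , profile g₁ g₂ g₃ g₄ =
  true ∷ D , profile f₁ (suc-right q o f₂) f₃ f₄ , profile g₁ g₂ (suc-right y o g₃) g₄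
subset-with-cell-counts (false ∷ X) (false ∷ Y) p p′ q q′ y y′ zero (suc o′) (profile e₁ e₂ e₃ e₄)
  with subset-with-cell-counts X Y p p′ q q′ y y′ 0 o′ (profile e₁ e₂ e₃ (suc-injective e₄))
... | D , profile f₁ f₂ f₃ f₄ , profile g₁ g₂ g₃ g₄ =
  false ∷ D , profile f₁ f₂ f₃ (suc-right q′ o′ f₄) , profile g₁ g₂ g₃ (suc-right y′ o′ g₄)

-- The profile of two r-subsets of a (2r + 1)-set meeting in a points, where r = a + b.
Overlap : ∀ {n} → ℕ → ℕ → Subset n → Subset n → Set
Overlap a b C B = Profile C B a b b (suc a)

overlap-size : ∀ {n a b} {C B : Subset n} → Overlap a b C B → ∣ C ∣ ≡ a + b
overlap-size {C = C} {B} (profile e₁ e₂ _ _) = trans (∣p∣≡∣p∩q∣+∣p─q∣ C B) (cong₂ _+_ e₁ e₂)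

overlap-of-sizes : ∀ {n r} (C B : Subset n) → suc (r + r) ≡ n → ∣ C ∣ ≡ r → ∣ B ∣ ≡ r →
  Overlap ∣ C ∩ B ∣ ∣ C ─ B ∣ C B
overlap-of-sizes {r = r} C B n≡ ∣C∣≡r ∣B∣≡r = profile refl refl b′≡b z≡1+a
  where
  a b b′ z : ℕ
  a  = ∣ C ∩ B ∣
  b  = ∣ C ─ B ∣
  b′ = ∣ B ─ C ∣
  z  = ∣ ∁ (C ∪ B) ∣
  a+b≡r : a + b ≡ r
  a+b≡r = trans (sym (∣p∣≡∣p∩q∣+∣p─q∣ C B)) ∣C∣≡r
  a+b′≡r : a + b′ ≡ r
  a+b′≡r = trans (cong (λ X → ∣ X ∣ + b′) (∩-comm C B)) (trans (sym (∣p∣≡∣p∩q∣+∣p─q∣ B C)) ∣B∣≡r)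
  b′≡b : b′ ≡ b
  b′≡b = +-cancelˡ-≡ a b′ b (trans a+b′≡r (sym a+b≡r))
  z≡1+a : z ≡ suc a
  z≡1+a = +-cancelˡ-≡ (r + b) z (suc a) (begin
    r + b + z      ≡⟨ cong (λ x → x + b + z) (sym a+b≡r) ⟩
    a + b + b + z  ≡⟨ cong (λ x → a + b + x + z) (sym b′≡b) ⟩
    a + b + b′ + z ≡⟨ trans (∣p∩q∣+∣p─q∣+∣q─p∣+∣∁p∪q∣≡n C B) (sym n≡) ⟩
    suc (r + r)    ≡⟨ cong (λ x → suc (r + x)) (sym a+b≡r) ⟩
    suc (r + (a + b)) ≡⟨ lemma r a b ⟩
    r + b + suc a  ∎)
    where
    open ≡-Reasoning
    lemma : ∀ r a b → suc (r + (a + b)) ≡ r + b + suc a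
    lemma = solve-∀

neighbour-swapping : ∀ {n a b} {X Y : Subset n} → Overlap a b X Y →
  Σ[ E ∈ Subset n ] Overlap b a E Y × X ∩ E ≡ ⊥
neighbour-swapping {a = a} {b} {X} {Y} P
  with subset-with-cell-counts X Y 0 a 0 b b 0 a 1
         (profile-cast refl refl (sym (+-identityʳ b)) (+-comm 1 a) P)
... | E , Q , R =
  E , profile-cast refl refl (+-identityʳ a) (+-comm b 1) Q , ∣p∣≡0⇒p≡⊥ (X ∩ E) (Profile.∣X∩Y∣ R)

neighbour-shrinking : ∀ {n a b} {X Y : Subset n} → Overlap a (suc b) X Y →
  Σ[ E ∈ Subset n ] Overlap b (suc a) E Y × X ∩ E ≡ ⊥
neighbour-shrinking {a = a} {b} {X} {Y} P
  with subset-with-cell-counts X Y 0 a 0 (suc b) b 1 (suc a) 0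
         (profile-cast refl refl (+-comm 1 b) (sym (+-identityʳ (suc a))) P)
... | E , Q , R =
  E , profile-cast refl refl (+-comm a 1) (+-identityʳ (suc b)) Q , ∣p∣≡0⇒p≡⊥ (X ∩ E) (Profile.∣X∩Y∣ R)

arc-colour : ∀ {k n} → Subset k → Subset k → (Fin n → Subset k) → APos n → Subset k
arc-colour X Y g s     = X
arc-colour X Y g e     = Y
arc-colour X Y g (m i) = g i

record ArcColouring (r : ℕ) {k : ℕ} (n : ℕ) (X Y : Subset k) : Set where
  constructor arc-colouring
  field
    colour : Fin n → Subset k
    size   : ∀ i → ∣ colour i ∣ ≡ r
    proper : ∀ {p q} → Step n p q → arc-colour X Y colour p ∩ arc-colour X Y colour q ≡ ⊥

arc-edge : ∀ {r k} {X Y : Subset k} → X ∩ Y ≡ ⊥ → ArcColouring r 0 X Y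
arc-edge X∩Y≡⊥ = arc-colouring (λ ()) (λ ()) λ { s→e → X∩Y≡⊥ }

arc-cons-proper : ∀ {k} n {X E Y : Subset k} {g : Fin n → Subset k} → X ∩ E ≡ ⊥ →
  (∀ {p q} → Step n p q → arc-colour E Y g p ∩ arc-colour E Y g q ≡ ⊥) →
  ∀ {p q} → Step (suc n) p q → arc-colour X Y (E ∷ᶠ g) p ∩ arc-colour X Y (E ∷ᶠ g) q ≡ ⊥
arc-cons-proper n       X∩E≡⊥ proper s→m           = X∩E≡⊥
arc-cons-proper (suc n) X∩E≡⊥ proper (m→m zero)    = proper s→m
arc-cons-proper (suc n) X∩E≡⊥ proper (m→m (suc j)) = proper (m→m j)
arc-cons-proper zero    X∩E≡⊥ proper m→e           = proper s→e
arc-cons-proper (suc n) X∩E≡⊥ proper m→e           = proper m→e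

arc-cons : ∀ {r k n} {X E Y : Subset k} → ∣ E ∣ ≡ r → X ∩ E ≡ ⊥ →
  ArcColouring r n E Y → ArcColouring r (suc n) X Y
arc-cons {n = n} ∣E∣≡r X∩E≡⊥ (arc-colouring g size proper) =
  arc-colouring (_ ∷ᶠ g) (λ { zero → ∣E∣≡r ; (suc i) → size i }) (arc-cons-proper n X∩E≡⊥ proper)

private
  neighbour-size : ∀ {k a b r} {E Y : Subset k} → Overlap b a E Y → a + b ≡ r → ∣ E ∣ ≡ r
  neighbour-size {a = a} {b} Q a+b≡r = trans (overlap-size Q) (trans (+-comm b a) a+b≡r)

-- An arc with n inner vertices is a walk of length n + 1 in the Kneser graph K(2r + 1, r).
mutual
  odd-arc : ∀ {r k a b} i {X Y : Subset k} → a + b ≡ r → a ≤ i → Overlap a b X Y →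
    ArcColouring r (i + i) X Y
  odd-arc zero {X} {Y} _ z≤n P = arc-edge (∣p∣≡0⇒p≡⊥ (X ∩ Y) (Profile.∣X∩Y∣ P))
  odd-arc {r} {a = a} {b} (suc i) {Y = Y} a+b≡r a≤1+i P with neighbour-swapping P
  ... | E , Q , X∩E≡⊥ =
    arc-cons (neighbour-size Q a+b≡r) X∩E≡⊥
      (subst (λ n → ArcColouring r n E Y) (sym (+-suc i i))
        (even-arc i (trans (+-comm b a) a+b≡r) a≤1+i Q))

  even-arc : ∀ {r k a b} i {X Y : Subset k} → a + b ≡ r → b ≤ suc i → Overlap a b X Y →
    ArcColouring r (suc (i + i)) X Y
  even-arc {a = a} {zero} i a+b≡r _ P with neighbour-swapping P
  ... | E , Q , X∩E≡⊥ =
    arc-cons (neighbour-size Q a+b≡r) X∩E≡⊥ (odd-arc i (trans (+-comm 0 a) a+b≡r) z≤n Q)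
  even-arc {r} {a = a} {suc b} i a+b≡r (s≤s b≤i) P with neighbour-shrinking P
  ... | E , Q , X∩E≡⊥ =
    arc-cons (neighbour-size Q 1+a+b≡r) X∩E≡⊥ (odd-arc i (trans (+-comm b (suc a)) 1+a+b≡r) b≤i Q)
    where
    1+a+b≡r : suc a + b ≡ r
    1+a+b≡r = trans (sym (+-suc a b)) a+b≡r

bead-colour : ∀ {k} (b : Bead) → Subset k → Subset k → (Internal b → Subset k) → BPos b → Subset k
bead-colour b C D ψ start   = C
bead-colour b C D ψ end     = D
bead-colour b C D ψ (int i) = ψ i

record BeadColouring (r : ℕ) {k : ℕ} (b : Bead) (C D : Subset k) : Set where
  constructor bead-colouring
  field
    colour : Internal b → Subset k
    size   : ∀ i → ∣ colour i ∣ ≡ r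
    proper : ∀ {p q} → BAdj b p q → bead-colour b C D colour p ∩ bead-colour b C D colour q ≡ ⊥

cycle-colouring : ∀ {r k a b} {C D : Subset k} →
  ArcColouring r a C D → ArcColouring r b C D → BeadColouring r (cycle a b) C D
cycle-colouring {r} {k} {a} {b} {C} {D}
                (arc-colouring g₁ size₁ proper₁) (arc-colouring g₂ size₂ proper₂) =
  bead-colouring ψ size proper
  where
  ψ : Internal (cycle a b) → Subset k
  ψ (inj₁ i) = g₁ i
  ψ (inj₂ i) = g₂ i
  size : ∀ i → ∣ ψ i ∣ ≡ r
  size (inj₁ i) = size₁ i
  size (inj₂ i) = size₂ i
  on-arc₁ : ∀ p → bead-colour (cycle a b) C D ψ (lift₁ p) ≡ arc-colour C D g₁ p
  on-arc₁ s     = refl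
  on-arc₁ e     = refl
  on-arc₁ (m i) = refl
  on-arc₂ : ∀ p → bead-colour (cycle a b) C D ψ (lift₂ p) ≡ arc-colour C D g₂ p
  on-arc₂ s     = refl
  on-arc₂ e     = refl
  on-arc₂ (m i) = refl
  proper : ∀ {p q} → BAdj (cycle a b) p q →
    bead-colour (cycle a b) C D ψ p ∩ bead-colour (cycle a b) C D ψ q ≡ ⊥
  proper (arc₁ {p = p} {q} st) =
    subst₂ (λ X Y → X ∩ Y ≡ ⊥) (sym (on-arc₁ p)) (sym (on-arc₁ q)) (proper₁ st)
  proper (arc₂ {p = p} {q} st) =
    subst₂ (λ X Y → X ∩ Y ≡ ⊥) (sym (on-arc₂ p)) (sym (on-arc₂ q)) (proper₂ st)

data ArcWalk {n : ℕ} : APos n → APos n → ℕ → Set where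
  []  : ∀ {p} → ArcWalk p p 0
  _∷_ : ∀ {p q w l} → Step n p q → ArcWalk q w l → ArcWalk p w (suc l)

shift : ∀ {n} → APos n → APos (suc n)
shift s     = m zero
shift e     = e
shift (m i) = m (suc i)

shift-walk : ∀ {n p q l} → ArcWalk {n} p q l → ArcWalk (shift p) (shift q) l
shift-walk []         = []
shift-walk (st ∷ ws) = shift-step st ∷ shift-walk ws
  where
  shift-step : ∀ {n p q} → Step n p q → Step (suc n) (shift p) (shift q)
  shift-step s→e     = m→e
  shift-step s→m     = m→m zero
  shift-step (m→m j) = m→m (suc j)
  shift-step m→e     = m→e

arc-walk : ∀ n → ArcWalk {n} s e (suc n)
arc-walk zero    = s→e ∷ []
arc-walk (suc n) = s→m ∷ shift-walk (arc-walk n)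

along-arc₁ : ∀ {a b bs p q l} → ArcWalk p q l →
  Walk (cycle a b ∷ bs) (embed (cycle a b) bs (lift₁ p)) (embed (cycle a b) bs (lift₁ q)) l
along-arc₁ []         = nil
along-arc₁ (st ∷ ws) = cons (inj₁ (here (arc₁ st))) (along-arc₁ ws)

along-arc₂ : ∀ {a b bs p q l} → ArcWalk p q l →
  Walk (cycle a b ∷ bs) (embed (cycle a b) bs (lift₂ p)) (embed (cycle a b) bs (lift₂ q)) l
along-arc₂ []         = nil
along-arc₂ (st ∷ ws) = cons (inj₁ (here (arc₂ st))) (along-arc₂ ws)

across-cycle : ∀ a b bs →
  Walk (cycle a b ∷ bs) (embed (cycle a b) bs start) (embed (cycle a b) bs end) (suc a ⊓ suc b)
across-cycle a b bs with ≤-total a b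
... | inj₁ a≤b = subst (Walk _ _ _) (sym (m≤n⇒m⊓n≡m (s≤s a≤b))) (along-arc₁ (arc-walk a))
... | inj₂ b≤a = subst (Walk _ _ _) (sym (m≥n⇒m⊓n≡n (s≤s b≤a))) (along-arc₂ (arc-walk b))

-- For |X ∩ Y| = α and |X ─ Y| = σ this is the shorter of the walk lengths 2α + 1 and
-- 2σ provided by odd-arc and even-arc.
kneser-distance : ℕ → ℕ → ℕ
kneser-distance α σ = (σ + σ) ⊓ suc (α + α)

kneser-distance≤2σ : ∀ α σ → kneser-distance α σ ≤ σ + σ
kneser-distance≤2σ α σ = m⊓n≤m (σ + σ) (suc (α + α))

kneser-distance≤1+2α : ∀ α σ → kneser-distance α σ ≤ suc (α + α)
kneser-distance≤1+2α α σ = m⊓n≤n (σ + σ) (suc (α + α))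

record BeadData (r : ℕ) (b : Bead) : Set where
  field
    α σ       : ℕ
    α+σ≡r     : α + σ ≡ r
    colouring : ∀ {k} {C D : Subset k} → Overlap α σ C D → BeadColouring r b C D
    crossing  : ∀ bs → Walk (b ∷ bs) (embed b bs start) (embed b bs end) (kneser-distance α σ)

edge-data : ∀ {r} → 1 ≤ r → BeadData r edge
edge-data {suc r} _ = record
  { α = 0 ; σ = suc r ; α+σ≡r = refl
  ; colouring = λ {_} {C} {D} P →
      bead-colouring (λ ()) (λ ()) λ { plain → ∣p∣≡0⇒p≡⊥ (C ∩ D) (Profile.∣X∩Y∣ P) }
  ; crossing = λ bs → subst (Walk _ _ _) (cong suc (sym (⊓-zeroʳ (r + suc r))))
                              (cons (inj₁ (here plain)) nil)
  }

private
  halve : ∀ n → Σ[ h ∈ ℕ ] (n ≡ h + h ⊎ n ≡ suc (h + h))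
  halve zero = 0 , inj₁ refl
  halve (suc n) with halve n
  ... | h , inj₁ n≡2h   = h , inj₂ (cong suc n≡2h)
  ... | h , inj₂ n≡2h+1 = suc h , inj₁ (trans (cong suc n≡2h+1) (sym (cong suc (+-suc h h))))

  double-injective : ∀ x y → x + x ≡ y + y → x ≡ y
  double-injective x y eq = trans (n≡⌊n+n/2⌋ x) (trans (cong ⌊_/2⌋ eq) (sym (n≡⌊n+n/2⌋ y)))

  double≢odd : ∀ x y → x + x ≢ suc (y + y)
  double≢odd x y eq = even≢odd x y (trans (cong (x +_) (+-identityʳ x))
                                     (trans eq (cong (λ z → suc (y + z)) (sym (+-identityʳ y)))))

  2r+1≡ : ∀ r → 2 * r + 1 ≡ suc (r + r)
  2r+1≡ = solve-∀

  2+2j≡ : ∀ j → suc (suc (j + j)) ≡ suc j + suc j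
  2+2j≡ j = cong suc (sym (+-suc j j))

cycle-arcs : ∀ {r} a b → a + b + 2 ≡ 2 * r + 1 →
  Σ[ i ∈ ℕ ] Σ[ j ∈ ℕ ] i + suc j ≡ r ×
    (a ≡ i + i × b ≡ suc (j + j) ⊎ a ≡ suc (j + j) × b ≡ i + i)
cycle-arcs {r} a b eq with halve a | halve b
... | i , inj₁ refl | j , inj₁ refl =
  ⊥-elim (double≢odd (suc (i + j)) r (trans (lemma i j) (trans eq (2r+1≡ r))))
  where
  lemma : ∀ i j → suc (i + j) + suc (i + j) ≡ i + i + (j + j) + 2
  lemma = solve-∀
... | i , inj₂ refl | j , inj₂ refl =
  ⊥-elim (double≢odd (suc (suc (i + j))) r (trans (lemma i j) (trans eq (2r+1≡ r))))
  where
  lemma : ∀ i j → suc (suc (i + j)) + suc (suc (i + j)) ≡ suc (i + i) + suc (j + j) + 2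
  lemma = solve-∀
... | i , inj₁ refl | j , inj₂ refl =
  i , j , double-injective _ r (suc-injective (trans (lemma i j) (trans eq (2r+1≡ r))))
        , inj₁ (refl , refl)
  where
  lemma : ∀ i j → suc ((i + suc j) + (i + suc j)) ≡ i + i + suc (j + j) + 2
  lemma = solve-∀
... | j , inj₂ refl | i , inj₁ refl =
  i , j , double-injective _ r (suc-injective (trans (lemma i j) (trans eq (2r+1≡ r))))
        , inj₂ (refl , refl)
  where
  lemma : ∀ i j → suc ((i + suc j) + (i + suc j)) ≡ suc (j + j) + (i + i) + 2
  lemma = solve-∀

cycle-data : ∀ {r} a b → a + b + 2 ≡ 2 * r + 1 → BeadData r (cycle a b)
cycle-data {r} a b eq with cycle-arcs {r} a b eq
... | i , j , i+1+j≡r , inj₁ (refl , refl) = record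
  { α = i ; σ = suc j ; α+σ≡r = i+1+j≡r
  ; colouring = λ P → cycle-colouring (odd-arc i i+1+j≡r ≤-refl P) (even-arc j i+1+j≡r ≤-refl P)
  ; crossing = λ bs → subst (Walk _ _ _) (trans (⊓-comm (suc (i + i)) _) (cong (_⊓ suc (i + i)) (2+2j≡ j)))
                              (across-cycle a b bs)
  }
... | i , j , i+1+j≡r , inj₂ (refl , refl) = record
  { α = i ; σ = suc j ; α+σ≡r = i+1+j≡r
  ; colouring = λ P → cycle-colouring (even-arc j i+1+j≡r ≤-refl P) (odd-arc i i+1+j≡r ≤-refl P)
  ; crossing = λ bs → subst (Walk _ _ _) (cong (_⊓ suc (i + i)) (2+2j≡ j)) (across-cycle a b bs)
  }

bead-data : ∀ {r} → 1 ≤ r → (b : Bead) → ValidBead (2 * r + 1) b → BeadData r b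
bead-data 1≤r edge        edge-ok       = edge-data 1≤r
bead-data 1≤r (cycle a b) (cycle-ok eq) = cycle-data a b eq

-- The Johnson distances b = |C ─ B|, σ = |C ─ D| and t = |D ─ B| of three r-subsets of
-- a (2r+1)-set obey the triangle inequalities and b + σ + t ≤ 2r + 1; with a = r − b and
-- α = r − σ the latter reads t ≤ 1 + a + α.
record Triangle (a b α σ t : ℕ) : Set where
  constructor triangle
  field
    b≤t+σ   : b ≤ t + σ
    σ≤b+t   : σ ≤ b + t
    t≤b+σ   : t ≤ b + σ
    t≤1+a+α : t ≤ suc (a + α)

private
  d+[x∸c]≤u : ∀ d x c u → d ≤ u → d + x ≤ c + u → d + (x ∸ c) ≤ u
  d+[x∸c]≤u d x c u d≤u d+x≤c+u with ≤-total x c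
  ... | inj₁ x≤c = subst (_≤ u) (sym (trans (cong (d +_) (m≤n⇒m∸n≡0 x≤c)) (+-identityʳ d))) d≤u
  ... | inj₂ c≤x = subst (_≤ u) (+-∸-assoc d c≤x) (m≤n+o⇒m∸n≤o (d + x) c d+x≤c+u)

-- The number of elements that D keeps from C ─ B: the least value compatible with the
-- capacities of the other three cells.
kept-outside : ℕ → ℕ → ℕ → ℕ → ℕ
kept-outside a α σ t = (α ∸ a) ⊔ (t ∸ σ) ⊔ (t ∸ suc a)

kept-outside-≤ : ∀ a α σ t d u → d ≤ u → d + α ≤ a + u → d + t ≤ σ + u → d + t ≤ suc a + u →
  d + kept-outside a α σ t ≤ u
kept-outside-≤ a α σ t d u d≤u h₁ h₂ h₃ = subst (_≤ u) (sym distribute)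
  (⊔-lub (⊔-lub (d+[x∸c]≤u d α a u d≤u h₁) (d+[x∸c]≤u d t σ u d≤u h₂)) (d+[x∸c]≤u d t (suc a) u d≤u h₃))
  where
  distribute : d + kept-outside a α σ t ≡ (d + (α ∸ a)) ⊔ (d + (t ∸ σ)) ⊔ (d + (t ∸ suc a))
  distribute = trans (+-distribˡ-⊔ d _ (t ∸ suc a))
                     (cong (_⊔ (d + (t ∸ suc a))) (+-distribˡ-⊔ d (α ∸ a) (t ∸ σ)))

private
  +-suc-comm : ∀ x y → x + suc y ≡ suc (y + x)
  +-suc-comm x y = trans (+-suc x y) (cong suc (+-comm x y))

  room : ∀ {x y z c} → x + y ≡ z → z ≤ c + x → y ≤ c
  room {x} {y} {z} {c} x+y≡z z≤c+x =
    +-cancelˡ-≤ x y c (≤-trans (≤-reflexive x+y≡z) (≤-trans z≤c+x (≤-reflexive (+-comm c x))))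

  complementary-sums : ∀ w x {w′ x′ u v c} → w + w′ ≡ u → x + x′ ≡ v → (w + x) + c ≡ u + v →
    w′ + x′ ≡ c
  complementary-sums w x {w′} {x′} {u} {v} {c} w+w′≡u x+x′≡v eq =
    +-cancelˡ-≡ (w + x) (w′ + x′) c
      (trans (interchange w x w′ x′) (trans (cong₂ _+_ w+w′≡u x+x′≡v) (sym eq)))

-- D keeps q elements of C ─ B, α − q of C ∩ B, and adds t − q elements outside C ∪ B and
-- σ − t + q of B ─ C; the hypotheses say that each of these fits into its cell.
intermediate-set-keeping : ∀ {k a b α σ a′ t} {C B : Subset k} q → α + σ ≡ a + b → a′ + t ≡ a + b →
  q ≤ α → q ≤ t → q ≤ b → α ≤ a + q → t ≤ σ + q → t ≤ suc a + q → σ + q ≤ b + t →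
  Overlap a b C B → Σ[ D ∈ Subset k ] Overlap α σ C D × Overlap a′ t D B
intermediate-set-keeping {a = a} {b} {α} {σ} {a′} {t} {C} {B} q α+σ≡r a′+t≡r
                         q≤α q≤t q≤b α≤a+q t≤σ+q t≤1+a+q σ+q≤b+t P
  with m≤n⇒∃[o]m+o≡n q≤α | m≤n⇒∃[o]m+o≡n q≤t | m≤n⇒∃[o]m+o≡n q≤b
... | p , q+p≡α | o , q+o≡t | q′ , q+q′≡b
  with m≤n⇒∃[o]m+o≡n (room q+p≡α α≤a+q) | m≤n⇒∃[o]m+o≡n (room q+o≡t t≤σ+q)
     | m≤n⇒∃[o]m+o≡n (room q+o≡t t≤1+a+q)
... | p′ , p+p′≡a | y , o+y≡σ | o′ , o+o′≡1+a
  with m≤n⇒∃[o]m+o≡n (room (trans (xy∙z≈xz∙y o q y) (cong (_+ q) o+y≡σ))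
                            (≤-trans σ+q≤b+t (≤-reflexive (cong (b +_) (trans (sym q+o≡t) (+-comm q o))))))
... | y′ , y+y′≡b
  with subset-with-cell-counts C B p p′ q q′ y y′ o o′
         (profile-cast (sym p+p′≡a) (sym q+q′≡b) (sym y+y′≡b) (sym o+o′≡1+a) P)
... | D , D─B , C─D =
  D , profile-cast p+q≡α p′+q′≡σ y+o≡σ y′+o′≡1+α C─D
    , profile-cast p+y≡a′ q+o≡t p′+y′≡t q′+o′≡1+a′ D─B
  where
  p+q≡α : p + q ≡ α
  p+q≡α = trans (+-comm p q) q+p≡α
  y+o≡σ : y + o ≡ σ
  y+o≡σ = trans (+-comm y o) o+y≡σ
  p+y≡a′ : p + y ≡ a′
  p+y≡a′ = +-cancelʳ-≡ t (p + y) a′ (begin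
    (p + y) + t         ≡⟨ cong ((p + y) +_) (sym q+o≡t) ⟩
    (p + y) + (q + o)   ≡⟨ interchange p y q o ⟩
    (p + q) + (y + o)   ≡⟨ cong₂ _+_ p+q≡α y+o≡σ ⟩
    α + σ               ≡⟨ trans α+σ≡r (sym a′+t≡r) ⟩
    a′ + t              ∎)
    where open ≡-Reasoning
  p′+q′≡σ : p′ + q′ ≡ σ
  p′+q′≡σ = complementary-sums p q p+p′≡a q+q′≡b (trans (cong (_+ σ) p+q≡α) α+σ≡r)
  y′+o′≡1+α : y′ + o′ ≡ suc α
  y′+o′≡1+α = complementary-sums y o y+y′≡b o+o′≡1+a
    (trans (cong (_+ suc α) y+o≡σ)
      (trans (+-suc-comm σ α) (trans (cong suc α+σ≡r) (sym (+-suc-comm b a)))))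
  p′+y′≡t : p′ + y′ ≡ t
  p′+y′≡t = complementary-sums p y p+p′≡a y+y′≡b (trans (cong (_+ t) p+y≡a′) a′+t≡r)
  q′+o′≡1+a′ : q′ + o′ ≡ suc a′
  q′+o′≡1+a′ = complementary-sums q o q+q′≡b o+o′≡1+a
    (trans (cong (_+ suc a′) q+o≡t)
      (trans (+-suc-comm t a′) (trans (cong suc a′+t≡r) (sym (+-suc-comm b a)))))

intermediate-set : ∀ {k r a b α σ a′ t} {C B : Subset k} →
  a + b ≡ r → α + σ ≡ r → a′ + t ≡ r → Triangle a b α σ t → Overlap a b C B →
  Σ[ D ∈ Subset k ] Overlap α σ C D × Overlap a′ t D B
intermediate-set {a = a} {b} {α} {σ} {a′} {t} refl α+σ≡r a′+t≡r (triangle b≤t+σ σ≤b+t t≤b+σ t≤1+a+α) =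
  intermediate-set-keeping q α+σ≡r a′+t≡r
    (kept-outside-≤ a α σ t 0 α z≤n (m≤n+m α a) (≤-trans t≤r (≤-reflexive (trans (sym α+σ≡r) (+-comm α σ))))
                    t≤1+a+α)
    (kept-outside-≤ a α σ t 0 t z≤n α≤a+t (m≤n+m t σ) (m≤n+m t (suc a)))
    (kept-outside-≤ a α σ t 0 b z≤n (≤-trans (m≤m+n α σ) (≤-reflexive α+σ≡r))
                    (≤-trans t≤b+σ (≤-reflexive (+-comm b σ))) (≤-trans t≤r (n≤1+n _)))
    (≤-trans (m≤n+m∸n α a) (+-monoʳ-≤ a (≤-trans (m≤m⊔n (α ∸ a) (t ∸ σ)) (m≤m⊔n _ (t ∸ suc a)))))
    (≤-trans (m≤n+m∸n t σ) (+-monoʳ-≤ σ (≤-trans (m≤n⊔m (α ∸ a) (t ∸ σ)) (m≤m⊔n _ (t ∸ suc a)))))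
    (≤-trans (m≤n+m∸n t (suc a)) (+-monoʳ-≤ (suc a) (m≤n⊔m _ (t ∸ suc a))))
    (kept-outside-≤ a α σ t σ (b + t) σ≤b+t σ+α≤a+[b+t] (+-monoʳ-≤ σ (m≤n+m t b))
                    (≤-trans (+-monoˡ-≤ t σ≤r) (≤-trans (≤-reflexive (+-assoc a b t)) (n≤1+n _))))
  where
  open ≤-Reasoning
  q : ℕ
  q = kept-outside a α σ t
  σ≤r : σ ≤ a + b
  σ≤r = ≤-trans (m≤n+m σ α) (≤-reflexive α+σ≡r)
  t≤r : t ≤ a + b
  t≤r = ≤-trans (m≤n+m t a′) (≤-reflexive a′+t≡r)
  α≤a+t : α ≤ a + t
  α≤a+t = +-cancelʳ-≤ σ α (a + t) (begin
    α + σ       ≡⟨ α+σ≡r ⟩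
    a + b       ≤⟨ +-monoʳ-≤ a b≤t+σ ⟩
    a + (t + σ) ≡⟨ sym (+-assoc a t σ) ⟩
    a + t + σ   ∎)
  σ+α≤a+[b+t] : σ + α ≤ a + (b + t)
  σ+α≤a+[b+t] = begin
    σ + α       ≡⟨ trans (+-comm σ α) α+σ≡r ⟩
    a + b       ≤⟨ m≤m+n (a + b) t ⟩
    a + b + t   ≡⟨ +-assoc a b t ⟩
    a + (b + t) ∎

-- The invariant of the colouring: the current end colour overlaps the target colour
-- in a points and the remaining beads have total length L.
Admissible : ℕ → ℕ → ℕ → Set
Admissible L a b = L ≡ b + b ⊎ L ≡ suc (a + a) ⊎ (a + a ≤ L × b + b ≤ suc L)

record NextOverlap (r a b α σ L : ℕ) : Set where
  constructor next-overlap
  field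
    {a′ t}       : ℕ
    a′+t≡r       : a′ + t ≡ r
    admissible   : Admissible L a′ t
    inequalities : Triangle a b α σ t

private
  half-≤ : ∀ x y → x + x ≤ suc (y + y) → x ≤ y
  half-≤ x y h = subst₂ _≤_ (sym (n≡⌊n+n/2⌋ x)) (sym (n≡⌈n+n/2⌉ y)) (⌊n/2⌋-mono h)

  complement : ∀ {x r} → x ≤ r → Σ[ y ∈ ℕ ] y + x ≡ r
  complement {x} x≤r = proj₁ (m≤n⇒∃[o]m+o≡n x≤r) , trans (+-comm _ x) (proj₂ (m≤n⇒∃[o]m+o≡n x≤r))

admissible-0 : ∀ {a b} → Admissible 0 a b → b ≡ 0
admissible-0 {b = b} (inj₁ 0≡2b)                = proj₁ (zero-sum b b 0≡2b)
admissible-0 {b = b} (inj₂ (inj₂ (_ , 2b≤1)))   = n≤0⇒n≡0 (half-≤ b 0 2b≤1)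

admissible-long : ∀ {r a b L} → a + b ≡ r → r + r ≤ L → Admissible L a b
admissible-long {a = a} {b} refl 2r≤L =
  inj₂ (inj₂ ( ≤-trans (+-mono-≤ (m≤m+n a b) (m≤m+n a b)) 2r≤L
             , ≤-trans (+-mono-≤ (m≤n+m b a) (m≤n+m b a)) (≤-trans 2r≤L (n≤1+n _))))

next-overlap-from-t : ∀ {r a b α σ L} t → a + b ≡ r → α + σ ≡ r → Triangle a b α σ t →
  (∀ {a′} → a′ + t ≡ r → Admissible L a′ t) → NextOverlap r a b α σ L
next-overlap-from-t {r} {a} {b} {α} {σ} t a+b≡r α+σ≡r tri admissible =
  next-overlap a′+t≡r (admissible a′+t≡r) tri
  where
  open Triangle tri
  open ≤-Reasoning
  t≤r : t ≤ r
  t≤r = half-≤ t r (begin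
    t + t                 ≤⟨ +-mono-≤ t≤b+σ t≤1+a+α ⟩
    (b + σ) + suc (a + α) ≡⟨ lemma a b α σ ⟩
    suc ((a + b) + (α + σ)) ≡⟨ cong suc (cong₂ _+_ a+b≡r α+σ≡r) ⟩
    suc (r + r)           ∎)
    where
    lemma : ∀ a b α σ → (b + σ) + suc (a + α) ≡ suc ((a + b) + (α + σ))
    lemma = solve-∀
  a′+t≡r : proj₁ (complement t≤r) + t ≡ r
  a′+t≡r = proj₂ (complement t≤r)

next-overlap-from-a′ : ∀ {r a b α σ L} a′ → a + b ≡ r → α + σ ≡ r →
  a′ ≤ a + σ → a′ ≤ α + b → a ≤ a′ + σ → b ≤ suc (a′ + α) →
  (∀ {t} → a′ + t ≡ r → Admissible L a′ t) → NextOverlap r a b α σ L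
next-overlap-from-a′ {a = a} {b} {α} {σ} a′ refl α+σ≡r a′≤a+σ a′≤α+b a≤a′+σ b≤1+a′+α admissible =
  next-overlap a′+t≡r (admissible a′+t≡r) (triangle b≤t+σ σ≤b+t t≤b+σ t≤1+a+α)
  where
  open ≤-Reasoning
  a′≤r : a′ ≤ a + b
  a′≤r = half-≤ a′ (a + b) (begin
    a′ + a′             ≤⟨ +-mono-≤ a′≤a+σ a′≤α+b ⟩
    (a + σ) + (α + b)   ≡⟨ lemma a b α σ ⟩
    (a + b) + (α + σ)   ≡⟨ cong ((a + b) +_) α+σ≡r ⟩
    (a + b) + (a + b)   ≤⟨ n≤1+n _ ⟩
    suc ((a + b) + (a + b)) ∎)
    where
    lemma : ∀ a b α σ → (a + σ) + (α + b) ≡ (a + b) + (α + σ)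
    lemma = solve-∀
  t : ℕ
  t = proj₁ (m≤n⇒∃[o]m+o≡n a′≤r)
  a′+t≡r : a′ + t ≡ a + b
  a′+t≡r = proj₂ (m≤n⇒∃[o]m+o≡n a′≤r)
  b≤t+σ : b ≤ t + σ
  b≤t+σ = +-cancelˡ-≤ a′ b (t + σ) (begin
    a′ + b       ≤⟨ +-monoˡ-≤ b a′≤a+σ ⟩
    a + σ + b    ≡⟨ xy∙z≈xz∙y a σ b ⟩
    a + b + σ    ≡⟨ cong (_+ σ) (sym a′+t≡r) ⟩
    a′ + t + σ   ≡⟨ +-assoc a′ t σ ⟩
    a′ + (t + σ) ∎)
  σ≤b+t : σ ≤ b + t
  σ≤b+t = +-cancelˡ-≤ a′ σ (b + t) (begin
    a′ + σ       ≤⟨ +-monoˡ-≤ σ a′≤α+b ⟩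
    α + b + σ    ≡⟨ xy∙z≈xz∙y α b σ ⟩
    α + σ + b    ≡⟨ cong (_+ b) (trans α+σ≡r (sym a′+t≡r)) ⟩
    a′ + t + b   ≡⟨ xy∙z≈x∙zy a′ t b ⟩
    a′ + (b + t) ∎)
  t≤b+σ : t ≤ b + σ
  t≤b+σ = +-cancelˡ-≤ a′ t (b + σ) (begin
    a′ + t       ≡⟨ a′+t≡r ⟩
    a + b        ≤⟨ +-monoˡ-≤ b a≤a′+σ ⟩
    a′ + σ + b   ≡⟨ xy∙z≈x∙zy a′ σ b ⟩
    a′ + (b + σ) ∎)
  t≤1+a+α : t ≤ suc (a + α)
  t≤1+a+α = +-cancelˡ-≤ a′ t (suc (a + α)) (begin
    a′ + t             ≡⟨ a′+t≡r ⟩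
    a + b              ≤⟨ +-monoʳ-≤ a b≤1+a′+α ⟩
    a + suc (a′ + α)   ≡⟨ lemma a a′ α ⟩
    a′ + suc (a + α)   ∎)
    where
    lemma : ∀ a a′ α → a + suc (a′ + α) ≡ a′ + suc (a + α)
    lemma = solve-∀

next-overlap-t≡h : ∀ {r a b α σ h} → a + b ≡ r → α + σ ≡ r →
  b ≤ h + σ → σ ≤ b + h → h ≤ b + σ → h ≤ suc (a + α) → NextOverlap r a b α σ (h + h)
next-overlap-t≡h {h = h} a+b≡r α+σ≡r b≤h+σ σ≤b+h h≤b+σ h≤1+a+α =
  next-overlap-from-t h a+b≡r α+σ≡r (triangle b≤h+σ σ≤b+h h≤b+σ h≤1+a+α) (λ _ → inj₁ refl)

next-overlap-a′≡h : ∀ {r a b α σ h} → a + b ≡ r → α + σ ≡ r →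
  h ≤ a + σ → h ≤ α + b → a ≤ h + σ → b ≤ suc (h + α) → NextOverlap r a b α σ (suc (h + h))
next-overlap-a′≡h {h = h} a+b≡r α+σ≡r h≤a+σ h≤α+b a≤h+σ b≤1+h+α =
  next-overlap-from-a′ h a+b≡r α+σ≡r h≤a+σ h≤α+b a≤h+σ b≤1+h+α (λ _ → inj₂ (inj₁ refl))

next-overlap-t≤h : ∀ {r a b α σ h} t → a + b ≡ r → α + σ ≡ r → Triangle a b α σ t →
  t ≤ h → r ≤ h + t → NextOverlap r a b α σ (h + h)
next-overlap-t≤h {h = h} t a+b≡r α+σ≡r tri t≤h r≤h+t =
  next-overlap-from-t t a+b≡r α+σ≡r tri λ {a′} a′+t≡r →
    let a′≤h = +-cancelʳ-≤ t a′ h (≤-trans (≤-reflexive a′+t≡r) r≤h+t)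
    in inj₂ (inj₂ (+-mono-≤ a′≤h a′≤h , ≤-trans (+-mono-≤ t≤h t≤h) (n≤1+n _)))

next-overlap-a′≤h : ∀ {r a b α σ h} a′ → a + b ≡ r → α + σ ≡ r →
  a′ ≤ a + σ → a′ ≤ α + b → a ≤ a′ + σ → b ≤ suc (a′ + α) →
  a′ ≤ h → r ≤ a′ + suc h → NextOverlap r a b α σ (suc (h + h))
next-overlap-a′≤h {h = h} a′ a+b≡r α+σ≡r h₁ h₂ h₃ h₄ a′≤h r≤a′+1+h =
  next-overlap-from-a′ a′ a+b≡r α+σ≡r h₁ h₂ h₃ h₄ λ {t} a′+t≡r →
    let t≤1+h = +-cancelˡ-≤ a′ t (suc h) (≤-trans (≤-reflexive a′+t≡r) r≤a′+1+h)
    in inj₂ (inj₂ ( ≤-trans (+-mono-≤ a′≤h a′≤h) (n≤1+n _)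
                  , ≤-trans (+-mono-≤ t≤1+h t≤1+h) (≤-reflexive (cong suc (+-suc h h)))))

-- The next end colour has t = min (h, b + σ, 1 + a + α) points outside B.
next-overlap-even-long : ∀ {r a b α σ h} → a + b ≡ r → α + σ ≡ r →
  b ≤ σ + h → a ≤ α + h → a ≤ σ + h → b ≤ suc (α + h) → NextOverlap r a b α σ (h + h)
next-overlap-even-long {a = a} {b} {α} {σ} {h} refl α+σ≡r b≤σ+h a≤α+h a≤σ+h b≤1+α+h
  with ≤-total h ((b + σ) ⊓ suc (a + α)) | ⊓-sel (b + σ) (suc (a + α))
... | inj₁ h≤u | _ =
  next-overlap-t≡h refl α+σ≡r (≤-trans b≤σ+h (≤-reflexive (+-comm σ h))) σ≤b+h
    (≤-trans h≤u (m⊓n≤m _ _)) (≤-trans h≤u (m⊓n≤n _ _))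
  where
  open ≤-Reasoning
  σ≤b+h : σ ≤ b + h
  σ≤b+h = +-cancelˡ-≤ α σ (b + h) (begin
    α + σ       ≡⟨ α+σ≡r ⟩
    a + b       ≤⟨ +-monoˡ-≤ b a≤α+h ⟩
    α + h + b   ≡⟨ xy∙z≈x∙zy α h b ⟩
    α + (b + h) ∎)
... | inj₂ u≤h | inj₁ u≡b+σ =
  next-overlap-t≤h (b + σ) refl α+σ≡r
    (triangle (≤-trans (m≤m+n b σ) (m≤m+n (b + σ) σ)) (≤-trans (m≤n+m σ b) (m≤n+m (b + σ) b)) ≤-refl
              (subst (_≤ suc (a + α)) u≡b+σ (m⊓n≤n _ _)))
    (subst (_≤ h) u≡b+σ u≤h)
    (≤-trans (+-monoˡ-≤ b a≤σ+h) (≤-reflexive (lemma σ h b)))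
  where
  lemma : ∀ σ h b → σ + h + b ≡ h + (b + σ)
  lemma = solve-∀
... | inj₂ u≤h | inj₂ u≡1+a+α =
  next-overlap-t≤h (suc (a + α)) refl α+σ≡r
    (triangle (≤-trans (≤-trans (m≤n+m b a) (≤-reflexive (sym α+σ≡r)))
                       (+-monoˡ-≤ σ (≤-trans (m≤n+m α a) (n≤1+n _))))
              (≤-trans (≤-trans (m≤n+m σ α) (≤-reflexive α+σ≡r))
                       (≤-trans (≤-reflexive (+-comm a b)) (+-monoʳ-≤ b (≤-trans (m≤m+n a α) (n≤1+n _)))))
              (subst (_≤ b + σ) u≡1+a+α (m⊓n≤m _ _)) ≤-refl)
    (subst (_≤ h) u≡1+a+α u≤h)
    (≤-trans (+-monoʳ-≤ a b≤1+α+h) (≤-reflexive (lemma a α h)))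
  where
  lemma : ∀ a α h → a + suc (α + h) ≡ h + suc (a + α)
  lemma = solve-∀

-- The next end colour has a′ = min (h, a + σ, α + b) points in common with B.
next-overlap-odd-long : ∀ {r a b α σ h} → a + b ≡ r → α + σ ≡ r →
  a ≤ σ + h → b ≤ suc (α + h) → a ≤ suc (α + h) → b ≤ suc (σ + h) → NextOverlap r a b α σ (suc (h + h))
next-overlap-odd-long {a = a} {b} {α} {σ} {h} refl α+σ≡r a≤σ+h b≤1+α+h a≤1+α+h b≤1+σ+h
  with ≤-total h ((a + σ) ⊓ (α + b)) | ⊓-sel (a + σ) (α + b)
... | inj₁ h≤u | _ =
  next-overlap-a′≡h refl α+σ≡r (≤-trans h≤u (m⊓n≤m _ _)) (≤-trans h≤u (m⊓n≤n _ _))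
    (≤-trans a≤σ+h (≤-reflexive (+-comm σ h))) (≤-trans b≤1+α+h (≤-reflexive (cong suc (+-comm α h))))
... | inj₂ u≤h | inj₁ u≡a+σ =
  next-overlap-a′≤h (a + σ) refl α+σ≡r ≤-refl (subst (_≤ α + b) u≡a+σ (m⊓n≤n _ _))
    (≤-trans (m≤m+n a σ) (m≤m+n (a + σ) σ))
    (≤-trans (≤-trans (m≤n+m b a) (≤-reflexive (trans (sym α+σ≡r) (+-comm α σ))))
             (≤-trans (+-monoˡ-≤ α (m≤n+m σ a)) (n≤1+n _)))
    (subst (_≤ h) u≡a+σ u≤h)
    (≤-trans (+-monoʳ-≤ a b≤1+σ+h) (≤-reflexive (lemma a σ h)))
  where
  lemma : ∀ a σ h → a + suc (σ + h) ≡ a + σ + suc h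
  lemma = solve-∀
... | inj₂ u≤h | inj₂ u≡α+b =
  next-overlap-a′≤h (α + b) refl α+σ≡r (subst (_≤ a + σ) u≡α+b (m⊓n≤m _ _)) ≤-refl
    (≤-trans (≤-trans (m≤m+n a b) (≤-reflexive (sym α+σ≡r))) (+-monoˡ-≤ σ (m≤m+n α b)))
    (≤-trans (m≤n+m b α) (≤-trans (m≤m+n (α + b) α) (n≤1+n _)))
    (subst (_≤ h) u≡α+b u≤h)
    (≤-trans (+-monoˡ-≤ b a≤1+α+h) (≤-reflexive (lemma α h b)))
  where
  lemma : ∀ α h b → suc (α + h) + b ≡ α + b + suc h
  lemma = solve-∀

private
  halve-≤ : ∀ x y {z} → x + x ≤ z → z ≤ suc (y + y) → x ≤ y
  halve-≤ x y x+x≤z z≤1+2y = half-≤ x y (≤-trans x+x≤z z≤1+2y)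

  double-+ : ∀ x y → (x + x) + (y + y) ≡ (x + y) + (x + y)
  double-+ x y = interchange x x y y

  double-+-odd : ∀ x y → (x + x) + suc (y + y) ≡ suc ((x + y) + (x + y))
  double-+-odd = solve-∀

  odd-+-odd : ∀ x y → suc (x + x) + suc (y + y) ≡ suc (x + y) + suc (x + y)
  odd-+-odd = solve-∀

next-overlap-even-σ+h≡b : ∀ {r a b α σ h} → a + b ≡ r → α + σ ≡ r → σ + h ≡ b →
  NextOverlap r a b α σ (h + h)
next-overlap-even-σ+h≡b {a = a} {α = α} {σ} {h} a+b≡r α+σ≡r refl =
  next-overlap-t≡h a+b≡r α+σ≡r (≤-reflexive (+-comm σ h))
    (≤-trans (m≤m+n σ h) (m≤m+n (σ + h) h)) (≤-trans (m≤n+m h σ) (m≤m+n (σ + h) σ))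
    (≤-trans (m≤n+m h a) (≤-trans (≤-reflexive (sym α≡a+h)) (≤-trans (m≤n+m α a) (n≤1+n _))))
  where
  α≡a+h : α ≡ a + h
  α≡a+h = +-cancelʳ-≡ σ α (a + h) (trans (trans α+σ≡r (sym a+b≡r))
            (trans (cong (a +_) (+-comm σ h)) (sym (+-assoc a h σ))))

next-overlap-even-α+h≡a : ∀ {r a b α σ h} → a + b ≡ r → α + σ ≡ r → α + h ≡ a →
  NextOverlap r a b α σ (h + h)
next-overlap-even-α+h≡a {b = b} {α} {σ} {h} a+b≡r α+σ≡r refl =
  next-overlap-t≡h a+b≡r α+σ≡r
    (subst (b ≤_) (cong (h +_) h+b≡σ) (≤-trans (m≤n+m b h) (m≤n+m (h + b) h)))
    (≤-reflexive (trans (sym h+b≡σ) (+-comm h b)))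
    (subst (h ≤_) (cong (b +_) h+b≡σ) (≤-trans (m≤m+n h b) (m≤n+m (h + b) b)))
    (≤-trans (m≤n+m h α) (≤-trans (m≤m+n (α + h) α) (n≤1+n _)))
  where
  h+b≡σ : h + b ≡ σ
  h+b≡σ = +-cancelˡ-≡ α (h + b) σ (trans (sym (+-assoc α h b)) (trans a+b≡r (sym α+σ≡r)))

next-overlap-even : ∀ {r a b α σ h} → a + b ≡ r → α + σ ≡ r →
  Admissible (kneser-distance α σ + (h + h)) a b → NextOverlap r a b α σ (h + h)
next-overlap-even {a = a} {b} {α} {σ} {h} a+b≡r α+σ≡r admissible
  with ⊓-sel (σ + σ) (suc (α + α)) | admissible
... | inj₁ ℓ≡2σ | inj₁ ℓ+2h≡2b =
  next-overlap-even-σ+h≡b a+b≡r α+σ≡r (double-injective (σ + h) b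
    (trans (sym (double-+ σ h)) (trans (cong (_+ (h + h)) (sym ℓ≡2σ)) ℓ+2h≡2b)))
... | inj₂ ℓ≡1+2α | inj₁ ℓ+2h≡2b =
  ⊥-elim (double≢odd b (α + h)
    (trans (sym ℓ+2h≡2b) (trans (cong (_+ (h + h)) ℓ≡1+2α) (cong suc (double-+ α h)))))
... | inj₂ ℓ≡1+2α | inj₂ (inj₁ ℓ+2h≡1+2a) =
  next-overlap-even-α+h≡a a+b≡r α+σ≡r (double-injective (α + h) a (suc-injective
    (trans (cong suc (sym (double-+ α h))) (trans (cong (_+ (h + h)) (sym ℓ≡1+2α)) ℓ+2h≡1+2a))))
... | inj₁ ℓ≡2σ | inj₂ (inj₁ ℓ+2h≡1+2a) =
  ⊥-elim (double≢odd (σ + h) a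
    (trans (sym (double-+ σ h)) (trans (cong (_+ (h + h)) (sym ℓ≡2σ)) ℓ+2h≡1+2a)))
... | _ | inj₂ (inj₂ (2a≤ℓ+2h , 2b≤1+ℓ+2h)) =
  next-overlap-even-long a+b≡r α+σ≡r
    (halve-≤ b (σ + h) 2b≤1+ℓ+2h
      (s≤s (≤-trans (+-monoˡ-≤ (h + h) ℓ≤2σ) (≤-reflexive (double-+ σ h)))))
    (halve-≤ a (α + h) 2a≤ℓ+2h
      (≤-trans (+-monoˡ-≤ (h + h) ℓ≤1+2α) (≤-reflexive (cong suc (double-+ α h)))))
    (halve-≤ a (σ + h) 2a≤ℓ+2h
      (≤-trans (+-monoˡ-≤ (h + h) ℓ≤2σ) (≤-trans (≤-reflexive (double-+ σ h)) (n≤1+n _))))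
    (halve-≤ b (suc (α + h)) 2b≤1+ℓ+2h
      (s≤s (≤-trans (+-monoˡ-≤ (h + h) ℓ≤1+2α) (≤-trans (≤-reflexive (cong suc (double-+ α h)))
        (≤-trans (n≤1+n _) (≤-reflexive (sym (+-suc (suc (α + h)) (α + h)))))))))
  where
  ℓ≤2σ : kneser-distance α σ ≤ σ + σ
  ℓ≤2σ = kneser-distance≤2σ α σ
  ℓ≤1+2α : kneser-distance α σ ≤ suc (α + α)
  ℓ≤1+2α = kneser-distance≤1+2α α σ

next-overlap-odd-1+α+h≡b : ∀ {r a b α σ h} → a + b ≡ r → α + σ ≡ r → suc (α + h) ≡ b →
  NextOverlap r a b α σ (suc (h + h))
next-overlap-odd-1+α+h≡b {a = a} {α = α} {σ} {h} a+b≡r α+σ≡r refl =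
  next-overlap-a′≡h a+b≡r α+σ≡r
    (≤-trans h≤σ (m≤n+m σ a))
    (≤-trans (≤-trans (m≤n+m h α) (n≤1+n _)) (m≤n+m _ α))
    (≤-trans (≤-trans (≤-trans (m≤m+n a h) (n≤1+n _)) (≤-reflexive (sym σ≡1+a+h))) (m≤n+m σ h))
    (≤-reflexive (cong suc (+-comm α h)))
  where
  σ≡1+a+h : σ ≡ suc (a + h)
  σ≡1+a+h = +-cancelˡ-≡ α σ (suc (a + h)) (trans (trans α+σ≡r (sym a+b≡r)) (lemma a α h))
    where
    lemma : ∀ a α h → a + suc (α + h) ≡ α + suc (a + h)
    lemma = solve-∀
  h≤σ : h ≤ σ
  h≤σ = ≤-trans (≤-trans (m≤n+m h a) (n≤1+n _)) (≤-reflexive (sym σ≡1+a+h))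

next-overlap-odd-σ+h≡a : ∀ {r a b α σ h} → a + b ≡ r → α + σ ≡ r → σ + h ≡ a →
  NextOverlap r a b α σ (suc (h + h))
next-overlap-odd-σ+h≡a {b = b} {α} {σ} {h} a+b≡r α+σ≡r refl =
  next-overlap-a′≡h a+b≡r α+σ≡r
    (≤-trans (m≤n+m h σ) (m≤m+n (σ + h) σ))
    (≤-trans (m≤m+n h b) (≤-trans (≤-reflexive (sym α≡h+b)) (m≤m+n α b)))
    (≤-reflexive (+-comm σ h))
    (≤-trans (m≤n+m b h) (≤-trans (≤-reflexive (sym α≡h+b)) (≤-trans (m≤n+m α h) (n≤1+n _))))
  where
  α≡h+b : α ≡ h + b
  α≡h+b = +-cancelʳ-≡ σ α (h + b) (trans (trans α+σ≡r (sym a+b≡r)) (lemma σ h b))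
    where
    lemma : ∀ σ h b → σ + h + b ≡ h + b + σ
    lemma = solve-∀

next-overlap-odd : ∀ {r a b α σ h} → a + b ≡ r → α + σ ≡ r →
  Admissible (kneser-distance α σ + suc (h + h)) a b → NextOverlap r a b α σ (suc (h + h))
next-overlap-odd {a = a} {b} {α} {σ} {h} a+b≡r α+σ≡r admissible
  with ⊓-sel (σ + σ) (suc (α + α)) | admissible
... | inj₂ ℓ≡1+2α | inj₁ ℓ+1+2h≡2b =
  next-overlap-odd-1+α+h≡b a+b≡r α+σ≡r (double-injective (suc (α + h)) b
    (trans (sym (odd-+-odd α h)) (trans (cong (_+ suc (h + h)) (sym ℓ≡1+2α)) ℓ+1+2h≡2b)))
... | inj₁ ℓ≡2σ | inj₁ ℓ+1+2h≡2b =
  ⊥-elim (double≢odd b (σ + h)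
    (trans (sym ℓ+1+2h≡2b) (trans (cong (_+ suc (h + h)) ℓ≡2σ) (double-+-odd σ h))))
... | inj₁ ℓ≡2σ | inj₂ (inj₁ ℓ+1+2h≡1+2a) =
  next-overlap-odd-σ+h≡a a+b≡r α+σ≡r (double-injective (σ + h) a (suc-injective
    (trans (sym (double-+-odd σ h)) (trans (cong (_+ suc (h + h)) (sym ℓ≡2σ)) ℓ+1+2h≡1+2a))))
... | inj₂ ℓ≡1+2α | inj₂ (inj₁ ℓ+1+2h≡1+2a) =
  ⊥-elim (double≢odd a (α + h) (trans (suc-injective
    (trans (sym ℓ+1+2h≡1+2a) (trans (cong (_+ suc (h + h)) ℓ≡1+2α) (odd-+-odd α h))))
    (+-suc (α + h) (α + h))))
... | _ | inj₂ (inj₂ (2a≤ℓ+1+2h , 2b≤2+ℓ+2h)) =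
  next-overlap-odd-long a+b≡r α+σ≡r
    (halve-≤ a (σ + h) 2a≤ℓ+1+2h
      (≤-trans (+-monoˡ-≤ (suc (h + h)) ℓ≤2σ) (≤-reflexive (double-+-odd σ h))))
    (halve-≤ b (suc (α + h)) 2b≤2+ℓ+2h
      (s≤s (≤-trans (+-monoˡ-≤ (suc (h + h)) ℓ≤1+2α) (≤-reflexive (odd-+-odd α h)))))
    (halve-≤ a (suc (α + h)) 2a≤ℓ+1+2h
      (≤-trans (+-monoˡ-≤ (suc (h + h)) ℓ≤1+2α) (≤-trans (≤-reflexive (odd-+-odd α h)) (n≤1+n _))))
    (halve-≤ b (suc (σ + h)) 2b≤2+ℓ+2h
      (s≤s (≤-trans (+-monoˡ-≤ (suc (h + h)) ℓ≤2σ) (≤-trans (≤-reflexive (double-+-odd σ h))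
        (≤-trans (n≤1+n _) (≤-reflexive (cong suc (sym (+-suc (σ + h) (σ + h))))))))))
  where
  ℓ≤2σ : kneser-distance α σ ≤ σ + σ
  ℓ≤2σ = kneser-distance≤2σ α σ
  ℓ≤1+2α : kneser-distance α σ ≤ suc (α + α)
  ℓ≤1+2α = kneser-distance≤1+2α α σ

next-overlap-exists : ∀ {r a b α σ L} → a + b ≡ r → α + σ ≡ r →
  Admissible (kneser-distance α σ + L) a b → NextOverlap r a b α σ L
next-overlap-exists {L = L} a+b≡r α+σ≡r admissible with halve L
... | h , inj₁ refl = next-overlap-even {h = h} a+b≡r α+σ≡r admissible
... | h , inj₂ refl = next-overlap-odd {h = h} a+b≡r α+σ≡r admissible

necklace-length : ∀ {r bs} → All (BeadData r) bs → ℕ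
necklace-length []       = 0
necklace-length (d ∷ ds) = kneser-distance (BeadData.α d) (BeadData.σ d) + necklace-length ds

walk-++ : ∀ {bs u v w l₁ l₂} → Walk bs u v l₁ → Walk bs v w l₂ → Walk bs u w (l₁ + l₂)
walk-++ nil          ws = ws
walk-++ (cons uv vs) ws = cons uv (walk-++ vs ws)

walk-there : ∀ {b bs u v l} → Walk bs u v l → Walk (b ∷ bs) (inj₂ u) (inj₂ v) l
walk-there nil                 = nil
walk-there (cons (inj₁ uv) vs) = cons (inj₁ (there uv)) (walk-there vs)
walk-there (cons (inj₂ vu) vs) = cons (inj₂ (there vu)) (walk-there vs)

necklace-walk : ∀ {r bs} (ds : All (BeadData r) bs) →
  Walk bs (startV bs) (endV bs) (necklace-length ds)
necklace-walk []                     = nil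
necklace-walk {bs = b ∷ bs} (d ∷ ds) = walk-++ (BeadData.crossing d bs) (walk-there (necklace-walk ds))

record NecklaceColouring (r : ℕ) {k : ℕ} (bs : List Bead) (C B : Subset k) : Set where
  constructor necklace-colouring
  field
    colour : Vertex bs → Subset k
    proper : IsFracColouring k r bs colour
    start≡ : colour (startV bs) ≡ C
    end≡   : colour (endV bs) ≡ B

empty-colouring : ∀ {r k} {C : Subset k} → ∣ C ∣ ≡ r → NecklaceColouring r [] C C
empty-colouring {C = C} ∣C∣≡r =
  necklace-colouring (λ _ → C) ((λ _ → ∣C∣≡r) , λ { _ _ (inj₁ ()) ; _ _ (inj₂ ()) }) refl refl

cons-colouring : ∀ {r k b bs} {C D B : Subset k} → ∣ C ∣ ≡ r →
  BeadColouring r b C D → NecklaceColouring r bs D B → NecklaceColouring r (b ∷ bs) C B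
cons-colouring {r} {k} {b} {bs} {C} {D} ∣C∣≡r (bead-colouring ψ ψ-size ψ-proper)
               (necklace-colouring φ (φ-size , φ-proper) φ-start φ-end) =
  necklace-colouring φ′ (φ′-size , φ′-proper) refl φ-end
  where
  φ′ : Vertex (b ∷ bs) → Subset k
  φ′ (inj₁ nothing)  = C
  φ′ (inj₁ (just i)) = ψ i
  φ′ (inj₂ v)        = φ v
  φ′-size : ∀ v → ∣ φ′ v ∣ ≡ r
  φ′-size (inj₁ nothing)  = ∣C∣≡r
  φ′-size (inj₁ (just i)) = ψ-size i
  φ′-size (inj₂ v)        = φ-size v
  on-bead : ∀ p → φ′ (embed b bs p) ≡ bead-colour b C D ψ p
  on-bead start   = refl
  on-bead end     = φ-start
  on-bead (int i) = refl
  adjacent : ∀ {u v} → Adj (b ∷ bs) u v → φ′ u ∩ φ′ v ≡ ⊥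
  adjacent (here {p = p} {q} pq) =
    subst₂ (λ X Y → X ∩ Y ≡ ⊥) (sym (on-bead p)) (sym (on-bead q)) (ψ-proper pq)
  adjacent (there {u = u} {v} uv) = φ-proper u v (inj₁ uv)
  φ′-proper : ∀ u v → Edge (b ∷ bs) u v → φ′ u ∩ φ′ v ≡ ⊥
  φ′-proper u v (inj₁ uv) = adjacent uv
  φ′-proper u v (inj₂ vu) = trans (∩-comm (φ′ u) (φ′ v)) (adjacent vu)

colour-necklace : ∀ {r k a b bs} (ds : All (BeadData r) bs) {C B : Subset k} →
  a + b ≡ r → Overlap a b C B → Admissible (necklace-length ds) a b → NecklaceColouring r bs C B
colour-necklace {r} {a = a} [] {C} {B} a+b≡r P admissible =
  subst (NecklaceColouring r [] C) C≡B (empty-colouring (trans (overlap-size P) a+b≡r))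
  where
  C≡B : C ≡ B
  C≡B = ∣p─q∣≡0⇒∣q─p∣≡0⇒p≡q C B (trans (Profile.∣X─Y∣ P) (admissible-0 {a} admissible))
                                 (trans (Profile.∣Y─X∣ P) (admissible-0 {a} admissible))
colour-necklace (d ∷ ds) a+b≡r P admissible
  with next-overlap-exists a+b≡r (BeadData.α+σ≡r d) admissible
... | next-overlap a′+t≡r admissible′ tri
  with intermediate-set a+b≡r (BeadData.α+σ≡r d) a′+t≡r tri P
... | D , C─D , D─B =
  cons-colouring (trans (overlap-size P) a+b≡r) (BeadData.colouring d C─D)
                 (colour-necklace ds a′+t≡r D─B admissible′)

corollary4p6 : (r : ℕ) → 2 ≤ r → (bs : List Bead) → IsNecklace (2 * r + 1) bs →
    DistAtLeast bs (startV bs) (endV bs) (2 * r + 1) →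
    (A B : Subset (2 * r + 1)) → ∣ A ∣ ≡ r → ∣ B ∣ ≡ r →
    Σ[ φ ∈ (Vertex bs → Subset (2 * r + 1)) ]
      (IsFracColouring (2 * r + 1) r bs φ × φ (startV bs) ≡ A × φ (endV bs) ≡ B)
corollary4p6 r 2≤r bs necklace far A B ∣A∣≡r ∣B∣≡r = colour , proper , start≡ , end≡
  where
  ds : All (BeadData r) bs
  ds = All.map (bead-data (≤-trans (n≤1+n 1) 2≤r) _) necklace
  P : Overlap ∣ A ∩ B ∣ ∣ A ─ B ∣ A B
  P = overlap-of-sizes A B (sym (2r+1≡ r)) ∣A∣≡r ∣B∣≡r
  a+b≡r : ∣ A ∩ B ∣ + ∣ A ─ B ∣ ≡ r
  a+b≡r = trans (sym (overlap-size P)) ∣A∣≡r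
  2r≤L : r + r ≤ necklace-length ds
  2r≤L = ≤-trans (n≤1+n _) (≤-trans (≤-reflexive (sym (2r+1≡ r))) (far _ (necklace-walk ds)))
  open NecklaceColouring (colour-necklace ds a+b≡r P (admissible-long {a = ∣ A ∩ B ∣} a+b≡r 2r≤L))
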